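{- Let $G=(V,E)$ and the algorithm be as described in the context, executed under the distributed adversarial daemon. If in some configuration $C$ of an execution two processes $i,j$ satisfy $p_i=j$ and $p_j=i$, then $p_i=j$ and $p_j=i$ also hold in every subsequent configuration $C'$ of the execution.
   Context: Let $G=(V,E)$ be a finite simple undirected graph; each node is a process and $N(i)$ denotes the set of neighbours of $i$. Each process has an identifier from a totally ordered set; identifiers of any two distinct processes at distance at most $2$ are distinct, and comparisons such as $j>i$ between processes are comparisons of their identifiers. Each process $i$ holds variables $m_i\in\{\text{true},\text{false}\}$ and $p_i\in\{null\}\cup N(i)$; a configuration is an assignment of values to all these variables. Define the predicate $PRmarried(i)\equiv \exists j\in N(i): (p_i=j \text{ and } p_j=i)$. The algorithm consists of the following four guarded rules for each process $i$ (a rule is enabled at $i$ if its guard holds; at most one rule is enabled at a process at any time): Update: if $m_i\neq PRmarried(i)$ then $m_i:=PRmarried(i)$. Marriage: if $m_i=PRmarried(i)$ and $p_i=null$ and there is $j\in N(i)$ with $p_j=i$, then $p_i:=j$ (for such a $j$). Seduction: if $m_i=PRmarried(i)$ and $p_i=null$ and $p_k\neq i$ for all $k\in N(i)$ and there is $j\in N(i)$ with $p_j=null$, $j>i$ and $m_j=\text{false}$, then $p_i:=\max\{j\in N(i): p_j=null,\ j>i,\ m_j=\text{false}\}$. Abandonment: if $m_i=PRmarried(i)$ and $p_i=j\neq null$ and $p_j\neq i$ and ($m_j=\text{true}$ or $j\le i$), then $p_i:=null$. A process is eligible if some rule is enabled at it. Under the distributed adversarial daemon, a step from a configuration $C$ consists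 of an arbitrary nonempty subset of the processes eligible in $C$ each executing its enabled rule, all guards and assignments being evaluated in $C$ (simultaneous execution); an execution is a maximal sequence of configurations, starting from an arbitrary configuration, each obtained from the previous one by a step. -}

module Defs where

open import Level using (0ℓ)
open import Data.Nat using (ℕ; zero; suc; _≤_)
open import Data.Fin using (Fin; toℕ; fromℕ; inject₁)
open import Data.Bool using (Bool; true; false)
open import Data.Maybe using (Maybe; just; nothing)
open import Data.Product using (Σ; ∃; _×_; _,_)
open import Data.Sum using (_⊎_)
open import Relation.Nullary using (¬_)
open import Relation.Binary.PropositionalEquality using (_≡_; _≢_)
open import Relation.Binary.Bundles using (StrictTotalOrder)

record Graph : Set₁ where
  field
    n       : ℕ
    Adj     : Fin n → Fin n → Set
    sym     : ∀ {i j} → Adj i j → Adj j i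
    irrefl  : ∀ {i} → ¬ Adj i i

record Network : Set₁ where
  field
    graph : Graph
  open Graph graph public
  field
    Ids   : StrictTotalOrder 0ℓ 0ℓ 0ℓ
  open StrictTotalOrder Ids public using (Carrier; _≈_; _<_)
  field
    ident    : Fin n → Carrier
    distinct : ∀ i j → i ≢ j →
               (Adj i j ⊎ Σ (Fin n) (λ k → Adj i k × Adj k j)) →
               ¬ (ident i ≈ ident j)

module Algorithm (N : Network) where
  open Network N

  _≺_ : Fin n → Fin n → Set
  i ≺ j = ident i < ident j

  _≼_ : Fin n → Fin n → Set
  i ≼ j = (ident i < ident j) ⊎ (ident i ≈ ident j)

  record Config : Set where
    field
      m     : Fin n → Bool
      p     : Fin n → Maybe (Fin n)
      p-nbr : ∀ i j → p i ≡ just j → Adj i j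
  open Config public

  PRmarried : Config → Fin n → Set
  PRmarried C i = Σ (Fin n) λ j → Adj i j × p C i ≡ just j × p C j ≡ just i

  -- "b = PRmarried(i)" for a boolean b
  Agrees : Config → Fin n → Bool → Set
  Agrees C i b = (b ≡ true → PRmarried C i) × (PRmarried C i → b ≡ true)

  Candidate : Config → Fin n → Fin n → Set
  Candidate C i j = Adj i j × p C j ≡ nothing × i ≺ j × m C j ≡ false

  -- Rule C i m' p' : some rule enabled at i in C, whose execution
  -- gives new values m' (for m_i) and p' (for p_i).
  data Rule (C : Config) (i : Fin n) : Bool → Maybe (Fin n) → Set where
    update      : ∀ {m'} → ¬ Agrees C i (m C i) → Agrees C i m' →
                  Rule C i m' (p C i)
    marriage    : ∀ j → Agrees C i (m C i) → p C i ≡ nothing →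
                  Adj i j → p C j ≡ just i →
                  Rule C i (m C i) (just j)
    seduction   : ∀ j → Agrees C i (m C i) → p C i ≡ nothing →
                  (∀ k → Adj i k → p C k ≢ just i) →
                  Candidate C i j →
                  (∀ k → Candidate C i k → ¬ (j ≺ k)) →
                  Rule C i (m C i) (just j)
    abandonment : ∀ j → Agrees C i (m C i) → p C i ≡ just j →
                  p C j ≢ just i → (m C j ≡ true ⊎ j ≼ i) →
                  Rule C i (m C i) nothing

  Eligible : Config → Fin n → Set
  Eligible C i = Σ Bool λ m' → Σ (Maybe (Fin n)) λ p' → Rule C i m' p'

  Terminal : Config → Set
  Terminal C = ∀ i → ¬ Eligible C i

  Step : Config → Config → Set
  Step C C' = Σ (Fin n → Bool) λ S →
      (Σ (Fin n) λ i → S i ≡ true)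
    × (∀ i → S i ≡ true → Rule C i (m C' i) (p C' i))
    × (∀ i → S i ≡ false → m C' i ≡ m C i × p C' i ≡ p C i)

  -- executions: maximal sequences of steps from an arbitrary configuration
  data Execution : Set where
    infinite : (s : ℕ → Config) → (∀ k → Step (s k) (s (suc k))) → Execution
    finite   : (len : ℕ) (s : Fin (suc len) → Config) →
               (∀ (k : Fin len) → Step (s (inject₁ k)) (s (Data.Fin.suc k))) →
               Terminal (s (fromℕ len)) → Execution

  Pos : Execution → Set
  Pos (infinite _ _)     = ℕ
  Pos (finite len _ _ _) = Fin (suc len)

  index : (e : Execution) → Pos e → ℕ
  index (infinite _ _)     k = k
  index (finite _ _ _ _)   k = toℕ k

  at : (e : Execution) → Pos e → Config
  at (infinite s _)     k = s k
  at (finite _ s _ _)   k = s k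

-- Among the four rules only Abandonment can move a pointer that is already
-- set, and it requires p_j ≠ i; so in a couple (p_i = j, p_j = i) every rule
-- executed at i or at j leaves its pointer in place.
module Submission where

open import Defs
open import Data.Nat using (ℕ; suc; _≤_; _≤′_; ≤′-refl; ≤′-step)
open import Data.Nat.Properties using (≤⇒≤′; suc-injective)
open import Data.Fin using (Fin; toℕ; inject₁)
import Data.Fin as Fin
open import Data.Fin.Properties using (toℕ-injective; toℕ-inject₁)
open import Data.Bool using (true; false)
open import Data.Maybe using (just)
open import Data.Maybe.Properties using (just-injective)
open import Data.Product using (_×_; _,_; proj₁; proj₂)
open import Data.Empty using (⊥-elim)
open import Relation.Binary.PropositionalEquality

preserved-≤′ : (Q : ℕ → Set) → (∀ k → Q k → Q (suc k)) →
               ∀ {k l} → k ≤′ l → Q k → Q l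
preserved-≤′ Q step ≤′-refl        q = q
preserved-≤′ Q step (≤′-step k≤′l) q = step _ (preserved-≤′ Q step k≤′l q)

preserved-Fin : ∀ {len} (Q : Fin (suc len) → Set) →
                (∀ (k : Fin len) → Q (inject₁ k) → Q (Fin.suc k)) →
                ∀ k l → toℕ k ≤ toℕ l → Q k → Q l
preserved-Fin Q step k l k≤l q =
  preserved-≤′ Q-at step-at (≤⇒≤′ k≤l)
    (λ k′ k′≡k → subst Q (toℕ-injective (sym k′≡k)) q) l refl
  where
  Q-at : ℕ → Set
  Q-at m = ∀ l → toℕ l ≡ m → Q l

  step-at : ∀ m → Q-at m → Q-at (suc m)
  step-at m q-at (Fin.suc l) l+1≡m+1 =
    step l (q-at (inject₁ l) (trans (toℕ-inject₁ l) (suc-injective l+1≡m+1)))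

module _ (N : Network) where
  open Network N hiding (sym)
  open Algorithm N

  Couple : Config → Fin n → Fin n → Set
  Couple C i j = p C i ≡ just j × p C j ≡ just i

  Invariant : (Config → Set) → Set
  Invariant Q = ∀ C C′ → Step C C′ → Q C → Q C′

  invariant-along : (Q : Config → Set) → Invariant Q →
                    (e : Execution) (k l : Pos e) → index e k ≤ index e l →
                    Q (at e k) → Q (at e l)
  invariant-along Q inv (infinite s steps) k l k≤l =
    preserved-≤′ (λ k → Q (s k)) (λ k → inv _ _ (steps k)) (≤⇒≤′ k≤l)
  invariant-along Q inv (finite len s steps _) k l =
    preserved-Fin (λ k → Q (s k)) (λ k → inv _ _ (steps k)) k l

  rule-keeps-partner : ∀ {C i j m′ p′} → Rule C i m′ p′ → Couple C i j → p′ ≡ just j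
  rule-keeps-partner (update _ _) (pᵢ , _) = pᵢ
  rule-keeps-partner (marriage _ _ pᵢ≡nothing _ _) (pᵢ , _)
    with () ← trans (sym pᵢ) pᵢ≡nothing
  rule-keeps-partner (seduction _ _ pᵢ≡nothing _ _ _) (pᵢ , _)
    with () ← trans (sym pᵢ) pᵢ≡nothing
  rule-keeps-partner (abandonment _ _ pᵢ≡just pⱼ≢i _) (pᵢ , pⱼ)
    with refl ← just-injective (trans (sym pᵢ) pᵢ≡just)
    = ⊥-elim (pⱼ≢i pⱼ)

  step-keeps-partner : ∀ C C′ {i j} → Step C C′ → Couple C i j → p C′ i ≡ just j
  step-keeps-partner C C′ {i} (S , _ , selected , unselected) couple with S i in Sᵢ
  ... | true  = rule-keeps-partner (selected i Sᵢ) couple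
  ... | false = trans (proj₂ (unselected i Sᵢ)) (proj₁ couple)

  couple-invariant : ∀ i j → Invariant (λ C → Couple C i j)
  couple-invariant i j C C′ step (pᵢ , pⱼ) =
    step-keeps-partner C C′ step (pᵢ , pⱼ) , step-keeps-partner C C′ step (pⱼ , pᵢ)

lemma5 : (N : Network) → let open Network N in
    let open Algorithm N in
    (e : Execution) (k l : Pos e) → index e k ≤ index e l →
    (i j : Fin n) →
    p (at e k) i ≡ just j → p (at e k) j ≡ just i →
    p (at e l) i ≡ just j × p (at e l) j ≡ just i
lemma5 N e k l k≤l i j pᵢ pⱼ =
  invariant-along N (λ C → Couple N C i j) (couple-invariant N i j) e k l k≤l (pᵢ , pⱼ)
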